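{- Let ${\cal G}$ be a graph model and let $M,N$ be closed $\lambda$-terms with $\alpha\in M^{\cal G}\setminus N^{\cal G}$. Then there exists a finite partial pair ${\cal A}\le{\cal G}$ such that for every partial pair ${\cal B}$ with ${\cal A}\le{\cal B}\le{\cal G}$, we have $\alpha\in M^{{\cal E}_{\cal B}}\setminus N^{{\cal E}_{\cal B}}$.
   Context: A partial pair is ${\cal A}=(A,c_{\cal A})$ with $c_{\cal A}:A^*\times A\rightharpoonup A$ partial injective ($A^*$ = finite subsets); a graph model is a partial pair with infinite carrier and total $c$. Interpretation of closed terms in a graph model or partial pair: $x_\rho=\rho(x)$; $(MN)_\rho=\{\alpha:\exists a\subseteq N_\rho\text{ finite},(a,\alpha)\in dom(c),c(a,\alpha)\in M_\rho\}$; $(\lambda x.M)_\rho=\{c(a,\alpha):(a,\alpha)\in dom(c),\alpha\in M_{\rho[x:=a]}\}$. ${\cal A}\le{\cal B}$ means $A\subseteq B$ and $c_{\cal B}=c_{\cal A}$ on $dom(c_{\cal A})$. The completion ${\cal E}_{\cal B}=(E_{\cal B},c_{{\cal E}_{\cal B}})$ of ${\cal B}$ is the graph model with $E_{\cal B}=\bigcup_n E_n$, $E_0=B$, $E_{n+1}=E_n\cup((E_n^*\times E_n)\setminus dom(c_{\cal B}))$, and $c_{{\cal E}_{\cal B}}(a,\alpha)=c_{\cal B}(a,\alpha)$ if defined and $(a,\alpha)$ otherwise. -}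

module Defs where

open import Data.Nat using (ℕ; zero; suc)
open import Data.Fin using (Fin; zero; suc)
open import Data.List using (List; []; _∷_; map)
open import Data.List.Membership.Propositional using (_∈_)
open import Data.List.Relation.Binary.Subset.Propositional using (_⊆_)
open import Data.List.Relation.Unary.All using (All)
open import Data.List.Relation.Unary.Any using (Any)
open import Data.Product using (Σ; _×_; _,_; ∃)
open import Data.Sum using (_⊎_)
open import Relation.Nullary using (¬_)
open import Relation.Binary.PropositionalEquality using (_≡_)

-- Closed λ-terms: de Bruijn terms with n free variables; closed = Term 0.

data Term : ℕ → Set where
  var : ∀ {n} → Fin n → Term n
  app : ∀ {n} → Term n → Term n → Term n
  lam : ∀ {n} → Term (suc n) → Term n

-- Finite subsets of a set X are represented by lists, identified up to
-- having the same members (_∼_).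

_∼_ : {X : Set} → List X → List X → Set
a ∼ b = (a ⊆ b) × (b ⊆ a)

-- A structure is given by a carrier
-- universe X, the equality _≈_ of its elements (used for membership in
-- finite sets), and the graph C a α β of the (partial) map c, i.e.
-- "c(a,α) is defined and equals β".

module Interp {X : Set} (_≈_ : X → X → Set) (C : List X → X → X → Set) where

  Env : ℕ → Set₁
  Env n = Fin n → X → Set

  ⟨_⟩ : List X → X → Set
  ⟨ a ⟩ x = Any (x ≈_) a

  extend : ∀ {n} → Env n → (X → Set) → Env (suc n)
  extend ρ s zero = s
  extend ρ s (suc i) = ρ i

  ⟦_⟧ : ∀ {n} → Term n → Env n → X → Set
  ⟦ var i ⟧ ρ x = ρ i x
  ⟦ app M N ⟧ ρ α = Σ (List X) λ a → All (⟦ N ⟧ ρ) a × Σ X λ β → C a α β × ⟦ M ⟧ ρ β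
  ⟦ lam M ⟧ ρ β = Σ (List X) λ a → Σ X λ α → C a α β × ⟦ M ⟧ (extend ρ ⟨ a ⟩) α

  emptyEnv : Env 0
  emptyEnv ()

  ⟦_⟧₀ : Term 0 → X → Set
  ⟦ M ⟧₀ = ⟦ M ⟧ emptyEnv

-- Finite subsets are lists; c only depends on the set of members of its
-- list argument, and is injective up to that identification.

record GraphModel : Set₁ where
  field
    D        : Set
    c        : List D → D → D
    c-set    : ∀ {a b α} → a ∼ b → c a α ≡ c b α
    c-inj    : ∀ {a b α β} → c a α ≡ c b β → (a ∼ b) × (α ≡ β)
    infinite : ¬ (Σ (List D) λ l → ∀ x → x ∈ l)

module _ (G : GraphModel) where
  open GraphModel G

  ⟦_⟧G : Term 0 → D → Set
  ⟦_⟧G = Interp.⟦_⟧₀ {D} _≡_ (λ a α β → c a α ≡ β)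

  -- Partial pairs B with B ≤ G: a subset of D together with the domain of
  -- c_B ⊆ B* × B, on which c_B agrees with c_G (so takes values in B).

  record SubPair : Set₁ where
    field
      In      : D → Set
      Dom     : List D → D → Set
      Dom-set : ∀ {a b α} → a ∼ b → Dom a α → Dom b α
      Dom-arg : ∀ {a α} → Dom a α → All In a × In α
      Dom-val : ∀ {a α} → Dom a α → In (c a α)
  open SubPair public

  -- A ≤ B  (for sub-pairs of G, c_B = c_A on dom c_A is automatic)
  _≤P_ : SubPair → SubPair → Set
  A ≤P B = (∀ x → In A x → In B x) × (∀ a α → Dom A a α → Dom B a α)

  FinitePair : SubPair → Set
  FinitePair A = Σ (List D) λ l → ∀ x → (In A x → x ∈ l) × (x ∈ l → In A x)

  -- The completion E_B.  Its elements live in the universe of trees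
  -- over D: leaf x is the element x ∈ B, node a α is the new element
  -- (a,α).

  data Tree : Set where
    leaf : D → Tree
    node : List Tree → Tree → Tree

  data _≈_ : Tree → Tree → Set where
    leaf≈ : ∀ {x} → leaf x ≈ leaf x
    node≈ : ∀ {a b α β} →
            All (λ x → Any (x ≈_) b) a →
            All (λ y → Any (y ≈_) a) b →
            α ≈ β → node a α ≈ node b β

  module Completion (B : SubPair) where

    InDom : List Tree → Tree → Set
    InDom a α = Σ (List D) λ l → Σ D λ x →
                (a ≡ map leaf l) × (α ≡ leaf x) × Dom B l x

    -- E_B = ⋃ E_n, E_0 = B, E_{n+1} = E_n ∪ ((E_n* × E_n) \ dom c_B)
    data InE : Tree → Set where
      leafE : ∀ {x} → In B x → InE (leaf x)
      nodeE : ∀ {a α} → All InE a → InE α → ¬ InDom a α → InE (node a α)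

    CE : List Tree → Tree → Tree → Set
    CE a α β = All InE a × InE α ×
      ( (Σ (List D) λ l → Σ D λ x → (a ≡ map leaf l) × (α ≡ leaf x) ×
           Dom B l x × (β ≈ leaf (c l x)))
      ⊎ (¬ InDom a α × (β ≈ node a α)) )

    ⟦_⟧E : Term 0 → Tree → Set
    ⟦_⟧E = Interp.⟦_⟧₀ _≈_ CE

{-# OPTIONS --safe #-}
module Submission where

open import Defs
open import Function using (id)
open import Data.Fin using (zero; suc)
open import Data.List using (List; []; _∷_; _++_; map; concatMap)
open import Data.List.Membership.Propositional using (_∈_)
open import Data.List.Relation.Binary.Subset.Propositional using (_⊆_)
open import Data.List.Membership.Propositional.Properties using (∈-concatMap⁺)
open import Data.List.Properties using (map-∘; map-id)
open import Data.List.Relation.Binary.Subset.Propositional.Properties using (⊆-refl; ⊆-trans)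
open import Data.List.Relation.Unary.All as All using (All; []; _∷_)
open import Data.List.Relation.Unary.All.Properties using (++⁻ˡ; ++⁻ʳ)
open import Data.List.Relation.Unary.Any as Any using (Any; here; there)
open import Data.List.Relation.Unary.Any.Properties using (gmap)
open import Data.Product using (Σ; _×_; _,_; proj₁; proj₂; swap; uncurry)
open import Data.Sum using (inj₁; inj₂)
open import Data.Unit using (⊤)
open import Relation.Nullary using (¬_)
open import Relation.Binary.PropositionalEquality using (_≡_; refl; sym; trans; cong)

-- A derivation of α ∈ M^G consults c at finitely many arguments (a, β), its
-- support.  Every B above the finite pair A generated by the support has these
-- arguments in dom(c_B), where c_{E_B} agrees with c_G, so the derivation can be
-- replayed verbatim on the leaves of E_B.  Conversely, collapsing each new
-- element (a, β) of E_B to c(a, β) maps E_B back into G and preserves c, so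
-- α ∈ N^{E_B} would give α ∈ N^G.

module Support {X : Set} (_≈_ : X → X → Set) (C : List X → X → X → Set) where
  open Interp _≈_ C

  mutual
    support : ∀ {n} (M : Term n) {ρ x} → ⟦ M ⟧ ρ x → List (List X × X)
    support (var i) _ = []
    support (app M N) {x = α} (a , Na , _ , _ , Mβ) = (a , α) ∷ supportAll N Na ++ support M Mβ
    support (lam M) (a , α , _ , Mα) = (a , α) ∷ support M Mα

    supportAll : ∀ {n} (N : Term n) {ρ a} → All (⟦ N ⟧ ρ) a → List (List X × X)
    supportAll N [] = []
    supportAll N (p ∷ ps) = support N p ++ supportAll N ps

module Transport
  {X Y : Set} (_≈X_ : X → X → Set) (CX : List X → X → X → Set)
  (_≈Y_ : Y → Y → Set) (CY : List Y → Y → Y → Set)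
  (f : X → Y) (f-≈ : ∀ {x y} → x ≈X y → f x ≈Y f y) where

  private
    module IX = Interp _≈X_ CX
    module IY = Interp _≈Y_ CY
  open Support _≈X_ CX

  Related : ∀ {n} → IX.Env n → IY.Env n → Set
  Related ρ σ = ∀ i {x} → ρ i x → σ i (f x)

  extend-Related : ∀ {n} {ρ : IX.Env n} {σ : IY.Env n} a → Related ρ σ →
                   Related (IX.extend ρ IX.⟨ a ⟩) (IY.extend σ IY.⟨ map f a ⟩)
  extend-Related a r zero = gmap f-≈
  extend-Related a r (suc i) = r i

  module _ (P : List X → X → Set)
           (f-C : ∀ {a α β} → P a α → CX a α β → CY (map f a) (f α) (f β)) where

    mutual
      ⟦⟧-transport : ∀ {n} (M : Term n) {ρ σ} → Related ρ σ → ∀ {x} (p : IX.⟦ M ⟧ ρ x) →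
                     All (uncurry P) (support M p) → IY.⟦ M ⟧ σ (f x)
      ⟦⟧-transport (var i) r p _ = r i p
      ⟦⟧-transport (app M N) r (a , Na , β , cβ , Mβ) (Pa ∷ Ps) =
        map f a , ⟦⟧-transport-All N r Na (++⁻ˡ _ Ps) , f β , f-C Pa cβ ,
        ⟦⟧-transport M r Mβ (++⁻ʳ _ Ps)
      ⟦⟧-transport (lam M) r (a , α , cα , Mα) (Pa ∷ Ps) =
        map f a , f α , f-C Pa cα , ⟦⟧-transport M (extend-Related a r) Mα Ps

      ⟦⟧-transport-All : ∀ {n} (N : Term n) {ρ σ} → Related ρ σ → ∀ {a} (ps : All (IX.⟦ N ⟧ ρ) a) →
                         All (uncurry P) (supportAll N ps) → All (IY.⟦ N ⟧ σ) (map f a)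
      ⟦⟧-transport-All N r [] _ = []
      ⟦⟧-transport-All N r (p ∷ ps) Ps =
        ⟦⟧-transport N r p (++⁻ˡ _ Ps) ∷ ⟦⟧-transport-All N r ps (++⁻ʳ _ Ps)

    ⟦⟧₀-transport : ∀ M {x} (p : IX.⟦ M ⟧₀ x) → All (uncurry P) (support M p) → IY.⟦ M ⟧₀ (f x)
    ⟦⟧₀-transport M = ⟦⟧-transport M (λ ())

  ⟦⟧₀-map : (∀ {a α β} → CX a α β → CY (map f a) (f α) (f β)) →
            ∀ M {x} → IX.⟦ M ⟧₀ x → IY.⟦ M ⟧₀ (f x)
  ⟦⟧₀-map f-C M p = ⟦⟧₀-transport (λ _ _ → ⊤) (λ _ → f-C) M p (All.universal _ _)

module _ (G : GraphModel) where
  open GraphModel G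

  graph : List D → D → D → Set
  graph a α β = c a α ≡ β

  open Support {D} _≡_ graph public

  factElements : List D × D → List D
  factElements (a , α) = c a α ∷ α ∷ a

  elements : List (List D × D) → List D
  elements = concatMap factElements

  ∈-elements : ∀ {F a α x} → (a , α) ∈ F → x ∈ c a α ∷ α ∷ a → x ∈ elements F
  ∈-elements fact∈F x∈fact = ∈-concatMap⁺ factElements (Any.map (λ { refl → x∈fact }) fact∈F)

  generatedPair : List (List D × D) → SubPair G
  generatedPair F = record
    { In      = _∈ elements F
    ; Dom     = λ a α → Σ (List D) λ b → (b , α) ∈ F × b ∼ a
    ; Dom-set = λ (a⊆a′ , a′⊆a) (b , m , (b⊆a , a⊆b)) → b , m , (⊆-trans b⊆a a⊆a′ , ⊆-trans a′⊆a a⊆b)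
    ; Dom-arg = λ (b , m , (_ , a⊆b)) →
                  All.tabulate (λ x∈a → ∈-elements m (there (there (a⊆b x∈a)))) ,
                  ∈-elements m (there (here refl))
    ; Dom-val = λ (b , m , b∼a) → ∈-elements m (here (c-set (swap b∼a)))
    }

  generatedPair-finite : ∀ F → FinitePair G (generatedPair F)
  generatedPair-finite F = elements F , λ _ → id , id

  generatedPair-Dom : ∀ F → All (uncurry (Dom (generatedPair F))) F
  generatedPair-Dom F = All.tabulate λ m → _ , m , (⊆-refl , ⊆-refl)

  mutual
    collapse : Tree G → D
    collapse (leaf x) = x
    collapse (node a α) = c (collapseAll a) (collapse α)

    collapseAll : List (Tree G) → List D
    collapseAll [] = []
    collapseAll (t ∷ ts) = collapse t ∷ collapseAll ts

  collapseAll≡map : ∀ ts → collapseAll ts ≡ map collapse ts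
  collapseAll≡map [] = refl
  collapseAll≡map (t ∷ ts) = cong (collapse t ∷_) (collapseAll≡map ts)

  collapse-leaves : ∀ l → map collapse (map leaf l) ≡ l
  collapse-leaves l = trans (sym (map-∘ l)) (map-id l)

  mutual
    collapse-≈ : ∀ {s t} → _≈_ G s t → collapse s ≡ collapse t
    collapse-≈ leaf≈ = refl
    collapse-≈ (node≈ a⊆b b⊆a α≈β) =
      trans (c-set (collapse-⊆ a⊆b , collapse-⊆ b⊆a)) (cong (c _) (collapse-≈ α≈β))

    collapse-⊆ : ∀ {a b} → All (λ s → Any (_≈_ G s) b) a → collapseAll a ⊆ collapseAll b
    collapse-⊆ (s∈b ∷ _) (here refl) = collapse-∈ s∈b
    collapse-⊆ (_ ∷ a⊆b) (there y∈a) = collapse-⊆ a⊆b y∈a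

    collapse-∈ : ∀ {s b} → Any (_≈_ G s) b → collapse s ∈ collapseAll b
    collapse-∈ (here s≈t) = here (collapse-≈ s≈t)
    collapse-∈ (there s∈b) = there (collapse-∈ s∈b)

  module _ (B : SubPair G) where
    open Completion G B

    collapse-CE : ∀ {a α β} → CE a α β → c (map collapse a) (collapse α) ≡ collapse β
    collapse-CE (_ , _ , inj₁ (l , x , refl , refl , _ , β≈)) =
      trans (cong (λ l′ → c l′ x) (collapse-leaves l)) (sym (collapse-≈ β≈))
    collapse-CE {a} (_ , _ , inj₂ (_ , β≈)) =
      trans (cong (λ a′ → c a′ _) (sym (collapseAll≡map a))) (sym (collapse-≈ β≈))

    leaves-InE : ∀ {l} → All (In B) l → All InE (map leaf l)
    leaves-InE [] = []
    leaves-InE (x ∷ xs) = leafE x ∷ leaves-InE xs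

    leaf-CE : ∀ {a α β} → Dom B a α → c a α ≡ β → CE (map leaf a) (leaf α) (leaf β)
    leaf-CE d refl = leaves-InE (proj₁ (Dom-arg B d)) , leafE (proj₂ (Dom-arg B d)) ,
                     inj₁ (_ , _ , refl , refl , d , leaf≈)

    ⟦⟧E⇒⟦⟧G : ∀ M {t} → ⟦ M ⟧E t → ⟦ G ⟧G M (collapse t)
    ⟦⟧E⇒⟦⟧G = Transport.⟦⟧₀-map (_≈_ G) CE _≡_ graph collapse collapse-≈ collapse-CE

    ⟦⟧G⇒⟦⟧E : ∀ M {x} (p : ⟦ G ⟧G M x) → All (uncurry (Dom B)) (support M p) → ⟦ M ⟧E (leaf x)
    ⟦⟧G⇒⟦⟧E = Transport.⟦⟧₀-transport _≡_ graph (_≈_ G) CE leaf (λ { refl → leaf≈ }) (Dom B) leaf-CE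

lemma6 : (G : GraphModel) (M N : Term 0) (α : GraphModel.D G) →
    ⟦ G ⟧G M α → ¬ ⟦ G ⟧G N α →
    Σ (SubPair G) λ A → FinitePair G A ×
      ((B : SubPair G) → _≤P_ G A B →
        Completion.⟦_⟧E G B M (leaf α) × ¬ Completion.⟦_⟧E G B N (leaf α))
lemma6 G M N α α∈M α∉N =
  generatedPair G F , generatedPair-finite G F , λ B (_ , A⊆B) →
    ⟦⟧G⇒⟦⟧E G B M α∈M (All.map (A⊆B _ _) (generatedPair-Dom G F)) ,
    λ α∈N → α∉N (⟦⟧E⇒⟦⟧G G B N α∈N)
  where
    F : List (List (GraphModel.D G) × GraphModel.D G)
    F = support G M α∈M
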